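{- Let $G=(V,E)$ be an undirected graph with edge capacities $c_G:E\to\mathbb R_+$, and let $\mathcal T$ be any cut-equivalent tree of $G$. Then $$\sum_{uv\in E}c_G(u,v)\cdot \mathrm{dist}_{\mathcal T}(u,v)\;\le\;2\sum_{uv\in E}c_G(u,v).$$
   Context: A cut-equivalent tree of $G$ is an edge-capacitated tree $\mathcal T$ on the node set $V$ such that for every pair of nodes $s,t$, every minimum $st$-cut in $\mathcal T$ (a single minimum-capacity edge on the $s$–$t$ path, whose removal splits $V$ into two parts) yields a bipartition of $V$ that is a minimum $st$-cut in $G$, of the same value as in $\mathcal T$. $\mathrm{dist}_{\mathcal T}(u,v)$ is the hop-distance, i.e., the number of edges on the unique $u$–$v$ path in $\mathcal T$ (ignoring capacities).
   Formalization: The edge capacities $c_G$ and the capacities of the tree $\mathcal T$ are rational instead of real. -}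

module Defs where

open import Data.Nat using (ℕ)
open import Data.Fin using (Fin)
open import Data.List using (List; []; _∷_; length; map; foldr; allFin)
open import Data.List.Membership.Propositional using (_∈_)
open import Data.List.Relation.Unary.Unique.Propositional using (Unique)
open import Data.Product using (Σ; ∃; _×_; _,_; proj₁)
open import Data.Sum using (_⊎_)
open import Data.Bool using (Bool; true; false; _xor_; if_then_else_)
open import Data.Integer using (+_)
open import Data.Rational using (ℚ; 0ℚ; _+_; _*_; _≤_; _/_)
open import Relation.Binary.PropositionalEquality using (_≡_; _≢_)
open import Relation.Nullary using (¬_)
open import Function.Bundles using (_⇔_)

Σℚ : ∀ {k} → (Fin k → ℚ) → ℚ
Σℚ {k} f = foldr _+_ 0ℚ (map f (allFin k))

ℕtoℚ : ℕ → ℚ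
ℕtoℚ d = (+ d) / 1

record CapGraph (n : ℕ) : Set where
  field
    k    : ℕ
    ends : Fin k → Fin n × Fin n
    cap  : Fin k → ℚ

open CapGraph public

endA : ∀ {n} (G : CapGraph n) → Fin (k G) → Fin n
endA G e = proj₁ (ends G e)

endB : ∀ {n} (G : CapGraph n) → Fin (k G) → Fin n
endB G e = Data.Product.proj₂ (ends G e)

Joins : ∀ {n} (G : CapGraph n) → Fin (k G) → Fin n → Fin n → Set
Joins G e u v = ends G e ≡ (u , v) ⊎ ends G e ≡ (v , u)

data Walk {n} (G : CapGraph n) : Fin n → Fin n → List (Fin n) → List (Fin (k G)) → Set where
  nil  : ∀ {s} → Walk G s s (s ∷ []) []
  cons : ∀ {u v t vs es} (e : Fin (k G)) → Joins G e u v →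
         Walk G v t vs es → Walk G u t (u ∷ vs) (e ∷ es)

Path : ∀ {n} (G : CapGraph n) → Fin n → Fin n → List (Fin (k G)) → Set
Path G s t es = ∃ λ vs → Walk G s t vs es × Unique vs

record IsTree {n} (T : CapGraph n) : Set where
  field
    loopless  : ∀ e → endA T e ≢ endB T e
    path      : ∀ s t → Σ (List (Fin (k T))) (Path T s t)
    pathUniq  : ∀ {s t es es'} → Path T s t es → Path T s t es' → es ≡ es'

open IsTree public

distT : ∀ {n} (T : CapGraph n) → IsTree T → Fin n → Fin n → ℕ
distT T tr u v = length (proj₁ (path tr u v))

ReachAvoid : ∀ {n} (T : CapGraph n) → Fin (k T) → Fin n → Fin n → Set
ReachAvoid T f s x = ∃ λ vs → ∃ λ es → Walk T s x vs es × ¬ (f ∈ es)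

cutValue : ∀ {n} (G : CapGraph n) → (Fin n → Bool) → ℚ
cutValue G S = Σℚ λ e → if S (endA G e) xor S (endB G e) then cap G e else 0ℚ

IsMinCut : ∀ {n} (G : CapGraph n) → Fin n → Fin n → (Fin n → Bool) → Set
IsMinCut {n} G s t S =
  S s ≡ true × S t ≡ false ×
  (∀ (S' : Fin n → Bool) → S' s ≡ true → S' t ≡ false → cutValue G S ≤ cutValue G S')

-- For all s ≠ t, every minimum-capacity edge f on
-- the s–t path of T, removing f splits V into (component of s, rest);
-- this bipartition must be a minimum st-cut of G of value cap T f.

IsCutEquivalentTree : ∀ {n} (G T : CapGraph n) → IsTree T → Set
IsCutEquivalentTree {n} G T tr =
  ∀ (s t : Fin n) → s ≢ t →
  ∀ (f : Fin (k T)) → f ∈ proj₁ (path tr s t) →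
  (∀ f' → f' ∈ proj₁ (path tr s t) → cap T f ≤ cap T f') →
  ∀ (S : Fin n → Bool) → (∀ x → (S x ≡ true) ⇔ ReachAvoid T f s x) →
  IsMinCut G s t S × cutValue G S ≡ cap T f

{-# OPTIONS --safe #-}
-- dist_T(u,v) counts the tree edges on the u–v path of T, so exchanging sums turns the left side
-- into Σ_f c(E_f), where E_f is the set of G-edges whose tree path uses the tree edge f. Every edge
-- in E_f crosses the side S_f of T − f containing one endpoint of f, and by cut-equivalence S_f is
-- a minimum cut of value c_T(f); hence the left side is at most Σ_f c_T(f). Rooting T, each tree
-- edge f is injectively assigned its child endpoint w, and c_T(f) ≤ c(δ{w}) because {w} separates
-- the endpoints of f. Finally Σ_w c(δ{w}) ≤ 2 Σ_e c(e), since each edge has two endpoints.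
module Submission where

open import Defs
open import Data.Nat using (ℕ; zero; suc)
open import Data.Rational using (ℚ; 0ℚ; 1ℚ; _+_; _*_; _≤_)

import Data.Nat as ℕ using (_*_)
import Data.Nat.Properties as ℕ using (*-identityʳ)
open import Data.Nat.Coprimality using (1-coprimeTo) renaming (sym to coprime-sym)
open import Data.Integer using () renaming (+_ to ⁺_)
open import Data.Rational.Properties
  using (≤-refl; ≤-reflexive; +-mono-≤; +-monoʳ-≤; +-identityˡ; +-identityʳ; *-identityˡ;
         *-identityʳ; *-zeroʳ; *-distribˡ-+; *-distribʳ-+; normalize-coprime;
         +-0-commutativeMonoid; module ≤-Reasoning)
open import Algebra.Properties.CommutativeMonoid.Sum +-0-commutativeMonoid
  using (sum; ∑-comm; ∑-distrib-+; sum-remove; sum-cong-≗; sum-replicate-zero)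
open import Data.Bool using (Bool; true; false; not; _∨_; _xor_; if_then_else_)
open import Data.Bool.Properties using (not-distribˡ-xor; not-distribʳ-xor; not-involutive)
open import Data.Fin using (Fin; zero; suc; punchIn; punchOut)
open import Data.Fin.Properties using (_≟_; suc-injective; punchIn-punchOut; punchOut-injective)
open import Data.List using (List; []; _∷_; _++_; length; map; foldr; tabulate; last)
open import Data.List.Membership.Propositional using (_∈_; _∉_)
open import Data.List.Membership.Propositional.Properties using (∈-++⁻)
import Data.List.Membership.DecPropositional as DecMembership
open import Data.List.Relation.Binary.Subset.Propositional using (_⊆_)
open import Data.List.Relation.Binary.Subset.Propositional.Properties using (⊆-refl; ∷⁺ʳ)
open import Data.List.Relation.Unary.All using ([]; _∷_)
open import Data.List.Relation.Unary.All.Properties using (¬Any⇒All¬)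
open import Data.List.Relation.Unary.AllPairs using ([]; _∷_)
open import Data.List.Relation.Unary.Any using (here; there)
open import Data.List.Relation.Unary.Unique.Propositional using (Unique)
open import Data.List.Relation.Unary.Unique.Propositional.Properties using (Unique[x∷xs]⇒x∉xs)
open import Data.Maybe using (just)
open import Data.Maybe.Properties using (just-injective)
open import Data.Product using (∃; _×_; _,_; proj₁; proj₂)
open import Data.Sum using (_⊎_; inj₁; inj₂; [_,_])
open import Data.Vec.Functional using (Vector; removeAt)
open import Function using (_∘_; id; _⇔_; mk⇔)
open import Function.Definitions using (Injective)
open import Relation.Binary.PropositionalEquality
  using (_≡_; _≢_; refl; sym; trans; cong; cong₂; subst; module ≡-Reasoning)
open import Relation.Nullary using (¬_; Dec; yes; no; does; contradiction)
open import Relation.Nullary.Decidable using (dec-true; dec-false)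

foldr-map-tabulate : ∀ {k} {A : Set} (f : A → ℚ) (g : Fin k → A) →
  foldr _+_ 0ℚ (map f (tabulate g)) ≡ sum (f ∘ g)
foldr-map-tabulate {zero} f g = refl
foldr-map-tabulate {suc k} f g = cong (f (g zero) +_) (foldr-map-tabulate f (g ∘ suc))

Σℚ≡sum : ∀ {k} (f : Vector ℚ k) → Σℚ f ≡ sum f
Σℚ≡sum f = foldr-map-tabulate f id

sum-mono-≤ : ∀ {k} {f g : Vector ℚ k} → (∀ i → f i ≤ g i) → sum f ≤ sum g
sum-mono-≤ {zero} _ = ≤-refl
sum-mono-≤ {suc k} f≤g = +-mono-≤ (f≤g zero) (sum-mono-≤ (f≤g ∘ suc))

sum-nonNeg : ∀ {k} {f : Vector ℚ k} → (∀ i → 0ℚ ≤ f i) → 0ℚ ≤ sum f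
sum-nonNeg {k} {f} 0≤f = subst (_≤ sum f) (sum-replicate-zero k) (sum-mono-≤ 0≤f)

sum-≤-whenInhabited : ∀ {k} {f : Vector ℚ k} {x} → 0ℚ ≤ x → (Fin k → sum f ≤ x) →
  sum f ≤ x
sum-≤-whenInhabited {zero} 0≤x _ = 0≤x
sum-≤-whenInhabited {suc k} _ bound = bound zero

sum-injective-≤ : ∀ {m n} (h : Vector ℚ n) (g : Fin m → Fin n) → Injective _≡_ _≡_ g →
  (∀ j → 0ℚ ≤ h j) → sum (h ∘ g) ≤ sum h
sum-injective-≤ {zero} h g _ 0≤h = sum-nonNeg 0≤h
sum-injective-≤ {suc m} {zero} h g = contradiction (g zero) λ ()
sum-injective-≤ {suc m} {suc n} h g g-inj 0≤h = begin
  h₀ + sum (h ∘ g ∘ suc)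
    ≡⟨ cong (h₀ +_) (sum-cong-≗ (cong h ∘ sym ∘ punchIn-punchOut ∘ g₀≢)) ⟩
  h₀ + sum (removeAt h (g zero) ∘ g′)
    ≤⟨ +-monoʳ-≤ h₀ (sum-injective-≤ _ g′ g′-inj (0≤h ∘ punchIn (g zero))) ⟩
  h₀ + sum (removeAt h (g zero))
    ≡⟨ sym (sum-remove h) ⟩
  sum h
    ∎
  where
  open ≤-Reasoning
  h₀ : ℚ
  h₀ = h (g zero)
  g₀≢ : ∀ i → g zero ≢ g (suc i)
  g₀≢ i eq = contradiction (g-inj eq) λ ()
  g′ : Fin m → Fin n
  g′ i = punchOut (g₀≢ i)
  g′-inj : Injective _≡_ _≡_ g′
  g′-inj {i} {j} eq = suc-injective (g-inj (punchOut-injective (g₀≢ i) (g₀≢ j) eq))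

sum-indicator : ∀ {k} (i : Fin k) (x : ℚ) → sum (λ j → if does (j ≟ i) then x else 0ℚ) ≡ x
sum-indicator {suc k} zero x = trans (cong (x +_) (sum-replicate-zero k)) (+-identityʳ x)
sum-indicator {suc k} (suc i) x = trans (+-identityˡ _) (sum-indicator i x)

indicator-nonNeg : ∀ (b : Bool) {c} → 0ℚ ≤ c → 0ℚ ≤ (if b then c else 0ℚ)
indicator-nonNeg true 0≤c = 0≤c
indicator-nonNeg false _ = ≤-refl

indicator-xor-≤ : ∀ (a b : Bool) {c} → 0ℚ ≤ c →
  (if a xor b then c else 0ℚ) ≤ (if a then c else 0ℚ) + (if b then c else 0ℚ)
indicator-xor-≤ true true 0≤c = +-mono-≤ 0≤c 0≤c
indicator-xor-≤ true false {c} _ = ≤-reflexive (sym (+-identityʳ c))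
indicator-xor-≤ false true {c} _ = ≤-reflexive (sym (+-identityˡ c))
indicator-xor-≤ false false _ = ≤-refl

ℕtoℚ-suc : ∀ m → ℕtoℚ (suc m) ≡ 1ℚ + ℕtoℚ m
ℕtoℚ-suc zero = refl
ℕtoℚ-suc m@(suc _) = begin
  ℕtoℚ (suc m)          ≡⟨ cong (ℕtoℚ ∘ suc) (sym (ℕ.*-identityʳ m)) ⟩
  -- for m ≢ 0 the sum 1ℚ + mkℚ (+ m) 0 _ normalises to this term by computation
  ℕtoℚ (suc (m ℕ.* 1))  ≡⟨ cong (1ℚ +_) (sym (normalize-coprime (coprime-sym (1-coprimeTo m)))) ⟩
  1ℚ + ℕtoℚ m           ∎
  where open ≡-Reasoning

_∈?_ : ∀ {m} (x : Fin m) (xs : List (Fin m)) → Dec (x ∈ xs)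
x ∈? xs = DecMembership._∈?_ _≟_ x xs

sum-membership : ∀ {k} {xs : List (Fin k)} → Unique xs → (c : ℚ) →
  sum (λ i → if does (i ∈? xs) then c else 0ℚ) ≡ c * ℕtoℚ (length xs)
sum-membership {k} {[]} _ c = trans (sum-replicate-zero k) (sym (*-zeroʳ c))
sum-membership {k} {x ∷ xs} uq@(_ ∷ uq′) c = begin
  -- i ∈? (x ∷ xs) decides i ≟ x first: its boolean is this disjunction by computation
  sum (λ i → if does (i ≟ x) ∨ does (i ∈? xs) then c else 0ℚ)
    ≡⟨ sum-cong-≗ split ⟩
  sum (λ i → 𝟙[ i ≟ x ] + 𝟙[ i ∈? xs ])
    ≡⟨ ∑-distrib-+ (λ i → 𝟙[ i ≟ x ]) (λ i → 𝟙[ i ∈? xs ]) ⟩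
  sum (λ i → 𝟙[ i ≟ x ]) + sum (λ i → 𝟙[ i ∈? xs ])
    ≡⟨ cong₂ _+_ (sum-indicator x c) (sum-membership uq′ c) ⟩
  c + c * ℕtoℚ (length xs)          ≡⟨ cong (_+ c * ℕtoℚ (length xs)) (sym (*-identityʳ c)) ⟩
  c * 1ℚ + c * ℕtoℚ (length xs)     ≡⟨ sym (*-distribˡ-+ c 1ℚ _) ⟩
  c * (1ℚ + ℕtoℚ (length xs))       ≡⟨ cong (c *_) (sym (ℕtoℚ-suc (length xs))) ⟩
  c * ℕtoℚ (length (x ∷ xs))        ∎
  where
  open ≡-Reasoning
  𝟙[_] : ∀ {A : Set} → Dec A → ℚ
  𝟙[ d ] = if does d then c else 0ℚ
  split : ∀ i →
    (if does (i ≟ x) ∨ does (i ∈? xs) then c else 0ℚ) ≡ 𝟙[ i ≟ x ] + 𝟙[ i ∈? xs ]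
  split i with i ≟ x | i ∈? xs
  ... | yes refl | yes x∈xs = contradiction x∈xs (Unique[x∷xs]⇒x∉xs uq)
  ... | yes _    | no _     = sym (+-identityʳ c)
  ... | no _     | yes _    = sym (+-identityˡ c)
  ... | no _     | no _     = sym (+-identityˡ 0ℚ)

module Walks {n} (G : CapGraph n) where

  Incident : Fin (k G) → Fin n → Set
  Incident e x = endA G e ≡ x ⊎ endB G e ≡ x

  joins-sym : ∀ {e u v} → Joins G e u v → Joins G e v u
  joins-sym (inj₁ eq) = inj₂ eq
  joins-sym (inj₂ eq) = inj₁ eq

  joins⇒incident : ∀ {e u v} → Joins G e u v → Incident e u
  joins⇒incident (inj₁ eq) = inj₁ (cong proj₁ eq)
  joins⇒incident (inj₂ eq) = inj₂ (cong proj₂ eq)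

  incident-joins : ∀ {e u v x} → Joins G e u v → Incident e x → x ≡ u ⊎ x ≡ v
  incident-joins (inj₁ refl) (inj₁ refl) = inj₁ refl
  incident-joins (inj₁ refl) (inj₂ refl) = inj₂ refl
  incident-joins (inj₂ refl) (inj₁ refl) = inj₂ refl
  incident-joins (inj₂ refl) (inj₂ refl) = inj₁ refl

  joins-other-end : ∀ {e u v v′} → Joins G e u v → Joins G e u v′ → v ≡ v′
  joins-other-end (inj₁ eq) (inj₁ eq′) with trans (sym eq) eq′
  ... | refl = refl
  joins-other-end (inj₁ eq) (inj₂ eq′) with trans (sym eq) eq′
  ... | refl = refl
  joins-other-end (inj₂ eq) (inj₁ eq′) with trans (sym eq) eq′
  ... | refl = refl
  joins-other-end (inj₂ eq) (inj₂ eq′) with trans (sym eq) eq′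
  ... | refl = refl

  walk-start-∈ : ∀ {s t vs es} → Walk G s t vs es → s ∈ vs
  walk-start-∈ nil = here refl
  walk-start-∈ (cons _ _ _) = here refl

  walk-end-∈ : ∀ {s t vs es} → Walk G s t vs es → t ∈ vs
  walk-end-∈ nil = here refl
  walk-end-∈ (cons _ _ w) = there (walk-end-∈ w)

  walk-incident-∈ : ∀ {s t vs es e x} → Walk G s t vs es → e ∈ es → Incident e x → x ∈ vs
  walk-incident-∈ (cons _ j w) (here refl) e∼x with incident-joins j e∼x
  ... | inj₁ refl = here refl
  ... | inj₂ refl = there (walk-start-∈ w)
  walk-incident-∈ (cons _ _ w) (there e∈es) e∼x = there (walk-incident-∈ w e∈es e∼x)

  unique-start-not-incident : ∀ {u v t vs es e} → Walk G v t vs es → Unique (u ∷ vs) →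
    e ∈ es → ¬ Incident e u
  unique-start-not-incident w uq e∈es e∼u = Unique[x∷xs]⇒x∉xs uq (walk-incident-∈ w e∈es e∼u)

  path-edges-unique : ∀ {s t vs es} → Walk G s t vs es → Unique vs → Unique es
  path-edges-unique nil _ = []
  path-edges-unique (cons _ j w) uq@(_ ∷ uq′) =
    ¬Any⇒All¬ _ (λ e∈es → unique-start-not-incident w uq e∈es (joins⇒incident j))
    ∷ path-edges-unique w uq′

  path-last-edge : ∀ {s t vs es e} → Walk G s t vs es → Unique vs → e ∈ es → Incident e t →
    last es ≡ just e
  path-last-edge (cons _ _ nil) _ (here refl) _ = refl
  path-last-edge (cons _ _ w@(cons _ _ _)) (_ ∷ uq′) (there e∈es) e∼t =
    path-last-edge w uq′ e∈es e∼t
  path-last-edge (cons _ j w@(cons _ _ w′)) uq@(_ ∷ uq′) (here refl) e∼t with incident-joins j e∼t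
  ... | inj₁ refl = contradiction (walk-end-∈ w) (Unique[x∷xs]⇒x∉xs uq)
  ... | inj₂ refl = contradiction (walk-end-∈ w′) (Unique[x∷xs]⇒x∉xs uq′)

  path-after-first-edge : ∀ {u v x vs es e} → Walk G u x vs es → Unique vs → e ∈ es →
    Joins G e u v → ReachAvoid G e v x
  path-after-first-edge (cons _ _ w) uq (there e∈es) e∼uv =
    contradiction (joins⇒incident e∼uv) (unique-start-not-incident w uq e∈es)
  path-after-first-edge (cons _ j w) uq (here refl) e∼uv rewrite joins-other-end e∼uv j =
    _ , _ , w , λ e∈es → unique-start-not-incident w uq e∈es (joins⇒incident j)

  walk-++ : ∀ {s m t vs vs′ es es′} → Walk G s m vs es → Walk G m t vs′ es′ →
    ∃ λ ws → Walk G s t ws (es ++ es′)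
  walk-++ nil w′ = _ , w′
  walk-++ (cons e j w) w′ = _ , cons e j (proj₂ (walk-++ w w′))

  ReachAvoid-trans : ∀ {f s m t} → ReachAvoid G f s m → ReachAvoid G f m t → ReachAvoid G f s t
  ReachAvoid-trans (_ , es , w , f∉es) (_ , es′ , w′ , f∉es′) =
    _ , es ++ es′ , proj₂ (walk-++ w w′) , [ f∉es , f∉es′ ] ∘ ∈-++⁻ es

  walk-reverse-ReachAvoid : ∀ {f s t vs es} → Walk G s t vs es → f ∉ es → ReachAvoid G f t s
  walk-reverse-ReachAvoid nil _ = _ , _ , nil , λ ()
  walk-reverse-ReachAvoid (cons e j w) f∉e∷es =
    ReachAvoid-trans (walk-reverse-ReachAvoid w (f∉e∷es ∘ there))
                     (_ , _ , cons e (joins-sym j) nil , λ { (here f≡e) → f∉e∷es (here f≡e) })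

  ReachAvoid-sym : ∀ {f s t} → ReachAvoid G f s t → ReachAvoid G f t s
  ReachAvoid-sym (_ , _ , w , f∉es) = walk-reverse-ReachAvoid w f∉es

  path-suffix : ∀ {s t vs es u} → Walk G s t vs es → Unique vs → u ∈ vs →
    ∃ λ es′ → Path G u t es′ × es′ ⊆ es
  path-suffix nil uq (here refl) = _ , (_ , nil , uq) , ⊆-refl
  path-suffix w@(cons _ _ _) uq (here refl) = _ , (_ , w , uq) , ⊆-refl
  path-suffix (cons _ _ w) (_ ∷ uq′) (there u∈vs) =
    let (es′ , p , es′⊆es) = path-suffix w uq′ u∈vs in es′ , p , there ∘ es′⊆es

  path-extend : ∀ {u v t vs es es₀ e} → Joins G e u v → Walk G v t vs es → Unique vs →
    es ⊆ es₀ → Dec (u ∈ vs) → ∃ λ es′ → Path G u t es′ × es′ ⊆ e ∷ es₀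
  path-extend _ w uq es⊆es₀ (yes u∈vs) =
    let (es′ , p , es′⊆es) = path-suffix w uq u∈vs in es′ , p , there ∘ es⊆es₀ ∘ es′⊆es
  path-extend {e = e} j w uq es⊆es₀ (no u∉vs) =
    _ , (_ , cons e j w , ¬Any⇒All¬ _ u∉vs ∷ uq) , ∷⁺ʳ e es⊆es₀

  walk⇒path : ∀ {s t vs es} → Walk G s t vs es → ∃ λ es′ → Path G s t es′ × es′ ⊆ es
  walk⇒path nil = [] , (_ , nil , [] ∷ []) , ⊆-refl
  walk⇒path (cons {u} e j w) =
    let (_ , (vs′ , w′ , uq′) , es′⊆es) = walk⇒path w
    in path-extend j w′ uq′ es′⊆es (u ∈? vs′)

module Tree {n} (T : CapGraph n) (tr : IsTree T) where
  open Walks T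

  treePath : Fin n → Fin n → List (Fin (k T))
  treePath u v = proj₁ (path tr u v)

  treePath-unique : ∀ u v → Unique (treePath u v)
  treePath-unique u v = let (_ , w , uq) = proj₂ (path tr u v) in path-edges-unique w uq

  treePath-last : ∀ {f u v} → f ∈ treePath u v → Incident f v → last (treePath u v) ≡ just f
  treePath-last {u = u} {v} = let (_ , w , uq) = proj₂ (path tr u v) in path-last-edge w uq

  treePath-edge : ∀ f → treePath (endA T f) (endB T f) ≡ f ∷ []
  treePath-edge f =
    pathUniq tr (proj₂ (path tr _ _)) (_ , cons f (inj₁ refl) nil , (loopless tr f ∷ []) ∷ [] ∷ [])

  ∈treePath-edge : ∀ f → f ∈ treePath (endA T f) (endB T f)
  ∈treePath-edge f = subst (f ∈_) (sym (treePath-edge f)) (here refl)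

  ReachAvoid⇒∉treePath : ∀ {f u v} → ReachAvoid T f u v → f ∉ treePath u v
  ReachAvoid⇒∉treePath {f} {u} {v} (_ , _ , w , f∉es) f∈path =
    let (_ , p , es′⊆es) = walk⇒path w
    in f∉es (es′⊆es (subst (f ∈_) (pathUniq tr (proj₂ (path tr u v)) p) f∈path))

  ∉treePath⇒ReachAvoid : ∀ {f u v} → f ∉ treePath u v → ReachAvoid T f u v
  ∉treePath⇒ReachAvoid {u = u} {v} f∉path =
    let (vs , w , _) = proj₂ (path tr u v) in vs , _ , w , f∉path

  ReachAvoid-common⇒∉treePath : ∀ {f m u v} → ReachAvoid T f m u → ReachAvoid T f m v →
    f ∉ treePath u v
  ReachAvoid-common⇒∉treePath m⇝u m⇝v =
    ReachAvoid⇒∉treePath (ReachAvoid-trans (ReachAvoid-sym m⇝u) m⇝v)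

  ∈treePath⇒ReachAvoid : ∀ {f x} → f ∈ treePath (endA T f) x → ReachAvoid T f (endB T f) x
  ∈treePath⇒ReachAvoid {f} {x} f∈ =
    let (_ , w , uq) = proj₂ (path tr (endA T f) x) in path-after-first-edge w uq f∈ (inj₁ refl)

  shore : Fin (k T) → Fin n → Bool
  shore f x = not (does (f ∈? treePath (endA T f) x))

  shore-spec : ∀ f x → (shore f x ≡ true) ⇔ ReachAvoid T f (endA T f) x
  shore-spec f x with f ∈? treePath (endA T f) x
  ... | yes f∈ = mk⇔ (λ ()) (λ a⇝x → contradiction f∈ (ReachAvoid⇒∉treePath a⇝x))
  ... | no f∉ = mk⇔ (λ _ → ∉treePath⇒ReachAvoid f∉) (λ _ → refl)

  treePath-crosses-shore : ∀ {f u v} → f ∈ treePath u v → (shore f u xor shore f v) ≡ true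
  treePath-crosses-shore {f} {u} {v} f∈
    with f ∈? treePath (endA T f) u | f ∈? treePath (endA T f) v
  ... | yes f∈u | yes f∈v = contradiction f∈
    (ReachAvoid-common⇒∉treePath (∈treePath⇒ReachAvoid f∈u) (∈treePath⇒ReachAvoid f∈v))
  ... | yes _ | no _ = refl
  ... | no _ | yes _ = refl
  ... | no f∉u | no f∉v = contradiction f∈
    (ReachAvoid-common⇒∉treePath (∉treePath⇒ReachAvoid f∉u) (∉treePath⇒ReachAvoid f∉v))

  indicator-treePath≤indicator-shore : ∀ f u v {c} → 0ℚ ≤ c →
    (if does (f ∈? treePath u v) then c else 0ℚ) ≤ (if shore f u xor shore f v then c else 0ℚ)
  indicator-treePath≤indicator-shore f u v 0≤c with f ∈? treePath u v
  ... | yes f∈ rewrite treePath-crosses-shore f∈ = ≤-refl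
  ... | no _ = indicator-nonNeg (shore f u xor shore f v) 0≤c

  module Rooted (r : Fin n) where

    childEnd : ∀ f → ∃ λ w → Incident f w × f ∈ treePath r w
    childEnd f with f ∈? treePath r (endB T f) | f ∈? treePath r (endA T f)
    ... | yes f∈ | _ = endB T f , inj₂ refl , f∈
    ... | no _ | yes f∈ = endA T f , inj₁ refl , f∈
    ... | no f∉b | no f∉a =
      contradiction (∈treePath-edge f)
        (ReachAvoid-common⇒∉treePath (∉treePath⇒ReachAvoid f∉a) (∉treePath⇒ReachAvoid f∉b))

    child : Fin (k T) → Fin n
    child = proj₁ ∘ childEnd

    child-incident : ∀ f → Incident f (child f)
    child-incident = proj₁ ∘ proj₂ ∘ childEnd

    child-injective : Injective _≡_ _≡_ child
    child-injective {f} {f′} eq =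
      just-injective (trans (sym (lastEdge f)) (trans (cong (last ∘ treePath r) eq) (lastEdge f′)))
      where
      lastEdge : ∀ g → last (treePath r (child g)) ≡ just g
      lastEdge g = treePath-last (proj₂ (proj₂ (childEnd g))) (child-incident g)

not-xor-not : ∀ x y → (not x xor not y) ≡ (x xor y)
not-xor-not x y =
  trans (sym (not-distribˡ-xor x (not y)))
        (trans (cong not (sym (not-distribʳ-xor x y))) (not-involutive (x xor y)))

double≡2* : ∀ x → x + x ≡ ℕtoℚ 2 * x
double≡2* x = begin
  x + x              ≡⟨ sym (cong₂ _+_ (*-identityˡ x) (*-identityˡ x)) ⟩
  1ℚ * x + 1ℚ * x    ≡⟨ sym (*-distribʳ-+ x 1ℚ 1ℚ) ⟩
  (1ℚ + 1ℚ) * x      ∎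
  where open ≡-Reasoning

singleton : ∀ {n} → Fin n → Fin n → Bool
singleton w x = does (w ≟ x)

module Cuts {n} (G : CapGraph n) (0≤cap : ∀ e → 0ℚ ≤ cap G e) where

  crossingCap : (Fin n → Bool) → Fin (k G) → ℚ
  crossingCap S e = if S (endA G e) xor S (endB G e) then cap G e else 0ℚ

  cutValue≡sum : ∀ S → cutValue G S ≡ sum (crossingCap S)
  cutValue≡sum S = Σℚ≡sum (crossingCap S)

  cutValue-nonNeg : ∀ S → 0ℚ ≤ cutValue G S
  cutValue-nonNeg S =
    subst (0ℚ ≤_) (sym (cutValue≡sum S)) (sum-nonNeg λ e → indicator-nonNeg _ (0≤cap e))

  cutValue-complement : ∀ S → cutValue G (not ∘ S) ≡ cutValue G S
  cutValue-complement S = begin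
    cutValue G (not ∘ S)         ≡⟨ cutValue≡sum (not ∘ S) ⟩
    sum (crossingCap (not ∘ S))  ≡⟨ sum-cong-≗ complement-crossing ⟩
    sum (crossingCap S)          ≡⟨ sym (cutValue≡sum S) ⟩
    cutValue G S                 ∎
    where
    open ≡-Reasoning
    complement-crossing : ∀ e → crossingCap (not ∘ S) e ≡ crossingCap S e
    complement-crossing e =
      cong (λ b → if b then cap G e else 0ℚ) (not-xor-not (S (endA G e)) (S (endB G e)))

  sum-singletonCuts≤2*sum-cap : sum (λ w → cutValue G (singleton w)) ≤ ℕtoℚ 2 * sum (cap G)
  sum-singletonCuts≤2*sum-cap = begin
    sum (λ w → cutValue G (singleton w))
      ≡⟨ sum-cong-≗ (cutValue≡sum ∘ singleton) ⟩
    sum (λ w → sum (crossingCap (singleton w)))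
      ≡⟨ ∑-comm (crossingCap ∘ singleton) ⟩
    sum (λ e → sum (λ w → crossingCap (singleton w) e))
      ≤⟨ sum-mono-≤ (λ e → sum-mono-≤ (crossing≤at-ends e)) ⟩
    sum (λ e → sum (λ w → at (endA G) w e + at (endB G) w e))
      ≡⟨ sum-cong-≗ sum-at-ends ⟩
    sum (λ e → cap G e + cap G e)
      ≡⟨ ∑-distrib-+ (cap G) (cap G) ⟩
    sum (cap G) + sum (cap G)
      ≡⟨ double≡2* (sum (cap G)) ⟩
    ℕtoℚ 2 * sum (cap G)
      ∎
    where
    open ≤-Reasoning
    at : (Fin (k G) → Fin n) → Fin n → Fin (k G) → ℚ
    at end w e = if singleton w (end e) then cap G e else 0ℚ
    crossing≤at-ends : ∀ e w → crossingCap (singleton w) e ≤ at (endA G) w e + at (endB G) w e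
    crossing≤at-ends e w =
      indicator-xor-≤ (singleton w (endA G e)) (singleton w (endB G e)) (0≤cap e)
    sum-at-ends : ∀ e → sum (λ w → at (endA G) w e + at (endB G) w e) ≡ cap G e + cap G e
    sum-at-ends e =
      trans (∑-distrib-+ (λ w → at (endA G) w e) (λ w → at (endB G) w e))
            (cong₂ _+_ (sum-indicator (endA G e) (cap G e)) (sum-indicator (endB G e) (cap G e)))

module CutEquivalent {n} (G T : CapGraph n) (0≤cap : ∀ e → 0ℚ ≤ cap G e)
                     (tr : IsTree T) (ce : IsCutEquivalentTree G T tr) where
  open Walks T using (Incident)
  open Tree T tr
  open Cuts G 0≤cap

  shore-isMinCut : ∀ f →
    IsMinCut G (endA T f) (endB T f) (shore f) × cutValue G (shore f) ≡ cap T f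
  shore-isMinCut f =
    ce (endA T f) (endB T f) (loopless tr f) f (∈treePath-edge f) minimal (shore f) (shore-spec f)
    where
    minimal : ∀ f′ → f′ ∈ treePath (endA T f) (endB T f) → cap T f ≤ cap T f′
    minimal f′ f′∈ with subst (f′ ∈_) (treePath-edge f) f′∈
    ... | here refl = ≤-refl

  cap≤separatingCut : ∀ f S → S (endA T f) ≡ true → S (endB T f) ≡ false → cap T f ≤ cutValue G S
  cap≤separatingCut f S a∈S b∉S =
    let (minCut , value) = shore-isMinCut f
    in subst (_≤ cutValue G S) value (proj₂ (proj₂ minCut) S a∈S b∉S)

  cap≤singletonCut : ∀ {f w} → Incident f w → cap T f ≤ cutValue G (singleton w)
  cap≤singletonCut {f} (inj₁ refl) =
    cap≤separatingCut f (singleton a) (dec-true (a ≟ a) refl) (dec-false (a ≟ b) (loopless tr f))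
    where a = endA T f ; b = endB T f
  cap≤singletonCut {f} (inj₂ refl) =
    subst (cap T f ≤_) (cutValue-complement (singleton b))
      (cap≤separatingCut f (not ∘ singleton b)
        (cong not (dec-false (b ≟ a) (loopless tr f ∘ sym))) (cong not (dec-true (b ≟ b) refl)))
    where a = endA T f ; b = endB T f

  weightedDist≤sum-cap : sum (λ e → cap G e * ℕtoℚ (distT T tr (endA G e) (endB G e))) ≤ sum (cap T)
  weightedDist≤sum-cap = begin
    sum (λ e → cap G e * ℕtoℚ (length (treePath (endA G e) (endB G e))))
      ≡⟨ sum-cong-≗ (λ e → sym (sum-membership (treePath-unique (endA G e) (endB G e)) (cap G e))) ⟩
    sum (λ e → sum (onPath e))               ≡⟨ ∑-comm onPath ⟩
    sum (λ f → sum (λ e → onPath e f))       ≤⟨ sum-mono-≤ (λ f → sum-mono-≤ (onPath≤crossing f)) ⟩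
    sum (λ f → sum (crossingCap (shore f)))  ≡⟨ sum-cong-≗ (sym ∘ cutValue≡sum ∘ shore) ⟩
    sum (λ f → cutValue G (shore f))         ≡⟨ sum-cong-≗ (proj₂ ∘ shore-isMinCut) ⟩
    sum (cap T)                              ∎
    where
    open ≤-Reasoning
    onPath : Fin (k G) → Fin (k T) → ℚ
    onPath e f = if does (f ∈? treePath (endA G e) (endB G e)) then cap G e else 0ℚ
    onPath≤crossing : ∀ f e → onPath e f ≤ crossingCap (shore f) e
    onPath≤crossing f e = indicator-treePath≤indicator-shore f (endA G e) (endB G e) (0≤cap e)

  sum-cap≤sum-singletonCuts : sum (cap T) ≤ sum (λ w → cutValue G (singleton w))
  sum-cap≤sum-singletonCuts =
    -- root T at an endpoint of any edge; without edges the left side is 0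
    sum-≤-whenInhabited (sum-nonNeg (cutValue-nonNeg ∘ singleton)) (rootedBound ∘ endA T)
    where
    rootedBound : Fin n → sum (cap T) ≤ sum (λ w → cutValue G (singleton w))
    rootedBound r = begin
      sum (cap T)                                   ≤⟨ sum-mono-≤ (cap≤singletonCut ∘ child-incident) ⟩
      sum (λ f → cutValue G (singleton (child f)))
        ≤⟨ sum-injective-≤ _ child child-injective (cutValue-nonNeg ∘ singleton) ⟩
      sum (λ w → cutValue G (singleton w))          ∎
      where
      open ≤-Reasoning
      open Rooted r

claim15 : ∀ {n : ℕ} (G T : CapGraph n) →
    (∀ e → 0ℚ ≤ cap G e) →
    (tr : IsTree T) → IsCutEquivalentTree G T tr →
    Σℚ (λ e → cap G e * ℕtoℚ (distT T tr (endA G e) (endB G e)))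
      ≤ ℕtoℚ 2 * Σℚ (λ e → cap G e)
claim15 G T 0≤cap tr ce = begin
  Σℚ (λ e → cap G e * ℕtoℚ (distT T tr (endA G e) (endB G e)))
    ≡⟨ Σℚ≡sum (λ e → cap G e * ℕtoℚ (distT T tr (endA G e) (endB G e))) ⟩
  sum (λ e → cap G e * ℕtoℚ (distT T tr (endA G e) (endB G e)))
    ≤⟨ weightedDist≤sum-cap ⟩
  sum (cap T)
    ≤⟨ sum-cap≤sum-singletonCuts ⟩
  sum (λ w → cutValue G (singleton w))
    ≤⟨ sum-singletonCuts≤2*sum-cap ⟩
  ℕtoℚ 2 * sum (cap G)
    ≡⟨ cong (ℕtoℚ 2 *_) (sym (Σℚ≡sum (cap G))) ⟩
  ℕtoℚ 2 * Σℚ (cap G)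
    ∎
  where
  open ≤-Reasoning
  open Cuts G 0≤cap using (sum-singletonCuts≤2*sum-cap)
  open CutEquivalent G T 0≤cap tr ce using (weightedDist≤sum-cap; sum-cap≤sum-singletonCuts)
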